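{- Fix an offline algorithm Off whose permutation $\pi^*$ does not change during the operation considered. Whenever DLM executes a fetch inside its final while loop (that is, fetch$(z)$ for an element $z$ with $b(z)\ge\pi(z)$ after the budget increases of the current request), we have $$\Delta\mathrm{DLM}+\Delta\Phi+\Delta\Psi\le0.$$ Here $\Delta\mathrm{DLM}$ is the cost of this fetch and $\Delta\Phi$, $\Delta\Psi$ are the changes of the potentials caused by it.
   Context: Online Min-Sum Set Cover with requests of cardinality at most $r$, over a universe $\mathcal U$ of $n$ elements. Lists are permutations $\mathcal U\to\{1,\dots,n\}$. Reordering costs one unit per swap of adjacent elements. Algorithm DLM. Every element $z$ has a budget $b(z)$, initially $0$. The operation fetch$(z)$ moves $z$ to position 1 by $\pi(z)-1$ adjacent swaps (cost $\pi(z)-1$), so every element that preceded $z$ moves back by one position, and then sets $b(z)\gets0$. On a request $R$ with $|R|=s$, let $x\in R$ be the element of $R$ with the smallest current position and let $\ell=\pi(x)$. DLM pays $\ell$ and executes fetch$(x)$. For every $y\in R\setminus\{x\}$ it sets $b(y)\gets b(y)+\ell/s$. Then, while some $z$ has $b(z)\ge\pi(z)$, it executes fetch$(z)$. Potentials. Let $\pi$ be DLM's current permutation and $\pi^*$ the current permutation of Off. Write $\pi(z)=2^{p(z)}+q(z)$ with $p(z)\ge0$ an integer and $0\le q(z)\le 2^{p(z)}-1$, and analogously $\pi^*(z)=2^{p^*(z)}+q^*(z)$. Set $\alpha=2$, $\gamma=5r$, $\beta=7.5r+5$ and $\kappa=\lceil\log_2(6\beta)\rceil$. Define - $\Phi_z=\alpha\,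 b(z)$ if $p(z)\le p^*(z)+\kappa$, and $\Phi_z=\beta\,\pi(z)-\gamma\, b(z)$ if $p(z)\ge p^*(z)+\kappa+1$; - $\Psi_z=0$ if $p(z)\le p^*(z)+\kappa-1$, and $\Psi_z=2\beta\, q(z)$ if $p(z)\ge p^*(z)+\kappa$. Set $\Phi=\sum_{z\in\mathcal U}\Phi_z$ and $\Psi=\sum_{z\in\mathcal U}\Psi_z$. -}

module Defs where

open import Data.Nat as ℕ using (ℕ; zero; suc; _∸_; _^_; NonZero)
open import Data.Nat.Logarithm using (⌊log₂_⌋; ⌈log₂_⌉)
open import Data.Integer using (+_)
open import Data.Rational as ℚ using (ℚ; 0ℚ; _/_)
open import Data.Fin using (Fin)
import Data.Fin.Properties as FinP
open import Data.List using (List; length)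
open import Data.List.Membership.Propositional using (_∈_)
import Data.List.Membership.DecPropositional as DecMem
open import Data.List.Relation.Unary.Unique.Propositional using (Unique)
open import Data.List.Relation.Unary.All using (All)
open import Data.Bool using (Bool; true; false; if_then_else_; _∧_; not)
open import Data.Product using (_×_)
open import Relation.Nullary using (does; ¬_)
open import Relation.Binary.PropositionalEquality using (_≡_)

-- Universe 𝒰 = Fin n.  A list is represented by its position map
-- π : Fin n → ℕ (positions 1..n).  IsPerm n π : π is a bijection
-- 𝒰 → {1,…,n} (injective with values in {1,…,n}; by finiteness this
-- is the same as bijective).

IsPerm : (n : ℕ) → (Fin n → ℕ) → Set
IsPerm n π = (∀ z → (1 ℕ.≤ π z) × (π z ℕ.≤ n)) × (∀ y z → π y ≡ π z → y ≡ z)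

record State (n : ℕ) : Set where
  constructor ⟨_,_⟩
  field
    pos    : Fin n → ℕ
    budget : Fin n → ℚ
open State public

fetchPos : ∀ {n} → (Fin n → ℕ) → Fin n → (Fin n → ℕ)
fetchPos π z y =
  if does (y FinP.≟ z) then 1
  else (if does (π y ℕ.<? π z) then suc (π y) else π y)

fetch : ∀ {n} → State n → Fin n → State n
fetch ⟨ π , b ⟩ z =
  ⟨ fetchPos π z , (λ y → if does (y FinP.≟ z) then 0ℚ else b y) ⟩

-- cost of fetch(z): π(z) − 1 adjacent swaps
fetchCost : ∀ {n} → State n → Fin n → ℕ
fetchCost s z = pos s z ∸ 1

record Request (n r : ℕ) : Set where
  field
    elems  : List (Fin n)
    unique : Unique elems
    card≥1 : 1 ℕ.≤ length elems
    card≤r : length elems ℕ.≤ r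
open Request public

card : ∀ {n r} → Request n r → ℕ
card R = length (elems R)

ratio : ℕ → (s : ℕ) → 1 ℕ.≤ s → ℚ
ratio ℓ (suc s) _ = (+ ℓ) / suc s

bump : ∀ {n : ℕ} → List (Fin n) → Fin n → ℚ → (Fin n → ℚ) → (Fin n → ℚ)
bump {n} R x inc b y =
  if does (y ∈? R) ∧ not (does (y FinP.≟ x)) then b y ℚ.+ inc else b y
  where open DecMem (FinP._≟_ {n}) using (_∈?_)

serve : ∀ {n r} → State n → Request n r → Fin n → State n
serve s R x =
  ⟨ pos (fetch s x)
  , bump (elems R) x (ratio (pos s x) (card R) (card≥1 R)) (budget (fetch s x)) ⟩

-- Reachable states of DLM (over any request sequence with |R| ≤ r,
-- starting from any initial list with all budgets 0).
--   between : state between two requests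
--   inLoop  : state inside the final while loop of some request
data Phase : Set where
  between inLoop : Phase

data Reach {n : ℕ} (r : ℕ) : Phase → State n → Set where
  init  : (π₀ : Fin n → ℕ) → IsPerm n π₀ → Reach r between ⟨ π₀ , (λ _ → 0ℚ) ⟩
  req   : ∀ {s} → Reach r between s → (R : Request n r) (x : Fin n) →
          x ∈ elems R → All (λ y → pos s x ℕ.≤ pos s y) (elems R) →
          Reach r inLoop (serve s R x)
  loop  : ∀ {s} → Reach r inLoop s → (z : Fin n) →
          (+ pos s z) / 1 ℚ.≤ budget s z → Reach r inLoop (fetch s z)
  done  : ∀ {s} → Reach r inLoop s →
          (∀ z → budget s z ℚ.< (+ pos s z) / 1) → Reach r between s

ℕ→ℚ : ℕ → ℚ
ℕ→ℚ k = (+ k) / 1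

-- π(z) = 2^p + q with 0 ≤ q ≤ 2^p − 1
pexp : ℕ → ℕ
pexp k = ⌊log₂ k ⌋

qrem : ℕ → ℕ
qrem k = k ∸ 2 ^ pexp k

αc : ℚ
αc = ℕ→ℚ 2

γc : ℕ → ℚ
γc r = ℕ→ℚ (5 ℕ.* r)

-- β = 7.5 r + 5 = (15 r + 10) / 2
βc : ℕ → ℚ
βc r = (+ (15 ℕ.* r ℕ.+ 10)) / 2

-- κ = ⌈log₂(6β)⌉, and 6β = 45 r + 30
κc : ℕ → ℕ
κc r = ⌈log₂ (45 ℕ.* r ℕ.+ 30) ⌉

Φz : ∀ {n} (r : ℕ) → State n → (Fin n → ℕ) → Fin n → ℚ
Φz r s π* z =
  if does (pexp (pos s z) ℕ.≤? pexp (π* z) ℕ.+ κc r)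
  then αc ℚ.* budget s z
  else βc r ℚ.* ℕ→ℚ (pos s z) ℚ.- γc r ℚ.* budget s z

-- Ψ_z  (p ≤ p* + κ − 1  ⇔  p < p* + κ)
Ψz : ∀ {n} (r : ℕ) → State n → (Fin n → ℕ) → Fin n → ℚ
Ψz r s π* z =
  if does (pexp (pos s z) ℕ.<? pexp (π* z) ℕ.+ κc r)
  then 0ℚ
  else ℕ→ℚ 2 ℚ.* βc r ℚ.* ℕ→ℚ (qrem (pos s z))

sumFin : (n : ℕ) → (Fin n → ℚ) → ℚ
sumFin zero    f = 0ℚ
sumFin (suc n) f = f Fin.zero ℚ.+ sumFin n (λ i → f (Fin.suc i))
  where import Data.Fin as Fin

Φ : ∀ {n} (r : ℕ) → State n → (Fin n → ℕ) → ℚ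
Φ {n} r s π* = sumFin n (Φz r s π*)

Ψ : ∀ {n} (r : ℕ) → State n → (Fin n → ℕ) → ℚ
Ψ {n} r s π* = sumFin n (Ψz r s π*)

module Submission where

-- Fetching z from position k costs k − 1.  The element z itself loses at least 2k of potential:
-- afterwards it sits at position 1, where Φ_z = Ψ_z = 0, while before the fetch Φ_z ≥ 2k,
-- because b(z) ≥ k and, inside the loop, b(z) ≤ 3π(z)/2.  Elements behind z do not move.
-- Each element y in front of z moves back by one position; this changes its potential by at
-- most 3β, and not at all unless its new level reaches p*(y) + κ.  In that case
-- π*(y) · 2^κ ≤ 2k, so by injectivity of π* and 2^κ ≥ 6β at most k / (3β) elements are
-- affected.  Altogether ΔDLM + ΔΦ + ΔΨ ≤ (k − 1) − 2k + k ≤ 0.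

open import Defs
open import Data.Nat using (ℕ)
open import Data.Fin using (Fin)

-- Binary logarithm

module _ where
  open import Data.Nat
  open import Data.Nat.Properties
  open import Data.Nat.Logarithm using (⌊log₂_⌋; ⌈log₂_⌉)
  open import Data.Nat.Logarithm.Core using (⌊log2⌋; ⌈log2⌉)
  open import Data.Nat.Induction using (<-wellFounded)
  open import Induction.WellFounded using (Acc; acc)
  open ≤-Reasoning

  private
    2*⌊n/2⌋≤n : ∀ n → 2 * ⌊ n /2⌋ ≤ n
    2*⌊n/2⌋≤n 0             = z≤n
    2*⌊n/2⌋≤n 1             = z≤n
    2*⌊n/2⌋≤n (suc (suc n)) rewrite *-suc 2 ⌊ n /2⌋ = s≤s (s≤s (2*⌊n/2⌋≤n n))

    n≤1+2*⌊n/2⌋ : ∀ n → n ≤ suc (2 * ⌊ n /2⌋)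
    n≤1+2*⌊n/2⌋ 0             = z≤n
    n≤1+2*⌊n/2⌋ 1             = ≤-refl
    n≤1+2*⌊n/2⌋ (suc (suc n)) rewrite *-suc 2 ⌊ n /2⌋ = s≤s (s≤s (n≤1+2*⌊n/2⌋ n))

    n≤2*⌈n/2⌉ : ∀ n → n ≤ 2 * ⌈ n /2⌉
    n≤2*⌈n/2⌉ 0             = z≤n
    n≤2*⌈n/2⌉ 1             = s≤s z≤n
    n≤2*⌈n/2⌉ (suc (suc n)) rewrite *-suc 2 ⌈ n /2⌉ = s≤s (s≤s (n≤2*⌈n/2⌉ n))

    2^⌊log2⌋≤n : ∀ n (rec : Acc _<_ n) → 1 ≤ n → 2 ^ ⌊log2⌋ n rec ≤ n
    2^⌊log2⌋≤n 1             _       _ = ≤-refl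
    2^⌊log2⌋≤n (suc (suc m)) (acc _) _ = begin
      2 * 2 ^ ⌊log2⌋ (suc ⌊ m /2⌋) _ ≤⟨ *-monoʳ-≤ 2 (2^⌊log2⌋≤n (suc ⌊ m /2⌋) _ (s≤s z≤n)) ⟩
      2 * suc ⌊ m /2⌋                ≡⟨ *-suc 2 ⌊ m /2⌋ ⟩
      2 + 2 * ⌊ m /2⌋                ≤⟨ +-monoʳ-≤ 2 (2*⌊n/2⌋≤n m) ⟩
      2 + m                          ∎

    n<2^suc⌊log2⌋ : ∀ n (rec : Acc _<_ n) → n < 2 ^ suc (⌊log2⌋ n rec)
    n<2^suc⌊log2⌋ 0             _       = s≤s z≤n
    n<2^suc⌊log2⌋ 1             _       = s≤s (s≤s z≤n)
    n<2^suc⌊log2⌋ (suc (suc m)) (acc _) = begin-strict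
      2 + m                                ≤⟨ +-monoʳ-≤ 2 (n≤1+2*⌊n/2⌋ m) ⟩
      3 + 2 * ⌊ m /2⌋                      <⟨ n<1+n _ ⟩
      4 + 2 * ⌊ m /2⌋                      ≡⟨ *-distribˡ-+ 2 2 ⌊ m /2⌋ ⟨
      2 * (2 + ⌊ m /2⌋)                    ≤⟨ *-monoʳ-≤ 2 (n<2^suc⌊log2⌋ (suc ⌊ m /2⌋) _) ⟩
      2 * 2 ^ suc (⌊log2⌋ (suc ⌊ m /2⌋) _) ∎

    n≤2^⌈log2⌉ : ∀ n (rec : Acc _<_ n) → n ≤ 2 ^ ⌈log2⌉ n rec
    n≤2^⌈log2⌉ 0             _       = z≤n
    n≤2^⌈log2⌉ 1             _       = ≤-refl
    n≤2^⌈log2⌉ (suc (suc m)) (acc _) = begin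
      2 + m                          ≤⟨ +-monoʳ-≤ 2 (n≤2*⌈n/2⌉ m) ⟩
      2 + 2 * ⌈ m /2⌉                ≡⟨ *-suc 2 ⌈ m /2⌉ ⟨
      2 * suc ⌈ m /2⌉                ≤⟨ *-monoʳ-≤ 2 (n≤2^⌈log2⌉ (suc ⌈ m /2⌉) _) ⟩
      2 * 2 ^ ⌈log2⌉ (suc ⌈ m /2⌉) _ ∎

  2^⌊log₂n⌋≤n : ∀ {n} → 1 ≤ n → 2 ^ ⌊log₂ n ⌋ ≤ n
  2^⌊log₂n⌋≤n {n} = 2^⌊log2⌋≤n n (<-wellFounded n)

  n<2^suc⌊log₂n⌋ : ∀ n → n < 2 ^ suc ⌊log₂ n ⌋
  n<2^suc⌊log₂n⌋ n = n<2^suc⌊log2⌋ n (<-wellFounded n)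

  n≤2^⌈log₂n⌉ : ∀ n → n ≤ 2 ^ ⌈log₂ n ⌉
  n≤2^⌈log₂n⌉ n = n≤2^⌈log2⌉ n (<-wellFounded n)

-- Levels of a position j = 2^(pexp j) + qrem j

module _ where
  open import Data.Nat
  open import Data.Nat.Properties
  open import Data.Nat.Logarithm using (⌊log₂_⌋; ⌊log₂⌋-mono-≤; ⌊log₂[2^n]⌋≡n)
  open import Relation.Binary.PropositionalEquality
  open import Relation.Nullary using (yes; no)
  open import Relation.Nullary.Negation using (contradiction)

  private
    2^m<2^suc[n]⇒m≤n : ∀ {m n} → 2 ^ m < 2 ^ suc n → m ≤ n
    2^m<2^suc[n]⇒m≤n {m} {n} lt with m ≤? n
    ... | yes m≤n = m≤n
    ... | no  m≰n = contradiction (^-monoʳ-≤ 2 (≰⇒> m≰n)) (<⇒≱ lt)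

  -- same-level has ≤ rather than ≡ because of j = 0, where qrem 0 = 0 ∸ 1 = 0.
  data LevelStep (j : ℕ) : Set where
    same-level : pexp (suc j) ≡ pexp j → qrem (suc j) ≤ suc (qrem j) → LevelStep j
    next-level : pexp (suc j) ≡ suc (pexp j) → qrem (suc j) ≡ 0 →
                 suc j ≡ 2 * suc (qrem j) → LevelStep j

  levelStep : ∀ j → LevelStep j
  levelStep zero = same-level refl z≤n
  levelStep j@(suc _) with suc j <? 2 ^ suc (pexp j)
  ... | yes sj<2^[p+1] = same-level p′≡p (≤-reflexive q′≡1+q)
    where
    p′≡p : pexp (suc j) ≡ pexp j
    p′≡p = ≤-antisym (2^m<2^suc[n]⇒m≤n (≤-<-trans (2^⌊log₂n⌋≤n (s≤s z≤n)) sj<2^[p+1]))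
                     (⌊log₂⌋-mono-≤ (n≤1+n j))
    q′≡1+q : qrem (suc j) ≡ suc (qrem j)
    q′≡1+q = trans (cong (λ p → suc j ∸ 2 ^ p) p′≡p) (+-∸-assoc 1 (2^⌊log₂n⌋≤n {j} (s≤s z≤n)))
  ... | no  sj≮2^[p+1] = next-level p′≡1+p q′≡0 sj≡2[1+q]
    where
    open ≡-Reasoning
    p = pexp j
    sj≡2^[p+1] : suc j ≡ 2 ^ suc p
    sj≡2^[p+1] = ≤-antisym (n<2^suc⌊log₂n⌋ j) (≮⇒≥ sj≮2^[p+1])
    p′≡1+p : pexp (suc j) ≡ suc p
    p′≡1+p = trans (cong ⌊log₂_⌋ sj≡2^[p+1]) (⌊log₂[2^n]⌋≡n (suc p))
    q′≡0 : qrem (suc j) ≡ 0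
    q′≡0 = begin
      suc j ∸ 2 ^ pexp (suc j) ≡⟨ cong₂ (λ a b → a ∸ 2 ^ b) sj≡2^[p+1] p′≡1+p ⟩
      2 ^ suc p ∸ 2 ^ suc p    ≡⟨ n∸n≡0 (2 ^ suc p) ⟩
      0                        ∎
    1+q≡2^p : suc (qrem j) ≡ 2 ^ p
    1+q≡2^p = begin
      suc (j ∸ 2 ^ p)             ≡⟨ +-∸-assoc 1 (2^⌊log₂n⌋≤n {j} (s≤s z≤n)) ⟨
      suc j ∸ 2 ^ p               ≡⟨ cong (_∸ 2 ^ p) sj≡2^[p+1] ⟩
      2 ^ p + (2 ^ p + 0) ∸ 2 ^ p ≡⟨ m+n∸m≡n (2 ^ p) (2 ^ p + 0) ⟩
      2 ^ p + 0                   ≡⟨ +-identityʳ (2 ^ p) ⟩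
      2 ^ p                       ∎
    sj≡2[1+q] : suc j ≡ 2 * suc (qrem j)
    sj≡2[1+q] = trans sj≡2^[p+1] (cong (2 *_) (sym 1+q≡2^p))

  crossing-bound : ∀ a κ {j k} → ⌊log₂ a ⌋ + κ ≤ ⌊log₂ suc j ⌋ → suc j ≤ k → a * 2 ^ κ ≤ 2 * k
  crossing-bound a κ {j} {k} level≤ sj≤k = begin
    a * 2 ^ κ                 ≤⟨ *-monoˡ-≤ (2 ^ κ) (<⇒≤ (n<2^suc⌊log₂n⌋ a)) ⟩
    2 ^ suc ⌊log₂ a ⌋ * 2 ^ κ ≡⟨ ^-distribˡ-+-* 2 (suc ⌊log₂ a ⌋) κ ⟨
    2 ^ suc (⌊log₂ a ⌋ + κ)   ≤⟨ ^-monoʳ-≤ 2 (s≤s level≤) ⟩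
    2 * 2 ^ ⌊log₂ suc j ⌋     ≤⟨ *-monoʳ-≤ 2 (2^⌊log₂n⌋≤n (s≤s z≤n)) ⟩
    2 * suc j                 ≤⟨ *-monoʳ-≤ 2 sj≤k ⟩
    2 * k                     ∎
    where open ≤-Reasoning

module _ where
  open import Data.Nat
  open import Data.Nat.Properties
  open import Data.Fin using (zero; suc)
  import Data.Fin.Properties as Fin
  open import Data.Bool using (Bool; true; false; if_then_else_; T)
  open import Data.Sum using (_⊎_; inj₁; inj₂)
  open import Function.Definitions using (Injective)
  open import Relation.Binary.PropositionalEquality
  open import Relation.Nullary using (yes; no; does)
  open import Relation.Nullary.Decidable using (dec-true; dec-false)
  open import Algebra.Properties.CommutativeSemigroup +-commutativeSemigroup using (interchange)

  fromBool : Bool → ℕ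
  fromBool b = if b then 1 else 0

  count : (n : ℕ) → (Fin n → Bool) → ℕ
  count zero    P = 0
  count (suc n) P = fromBool (P zero) + count n (λ i → P (suc i))

  count-false : ∀ n {P : Fin n → Bool} → (∀ y → P y ≡ false) → count n P ≡ 0
  count-false zero    _   = refl
  count-false (suc n) P≡f rewrite P≡f zero = count-false n (λ i → P≡f (suc i))

  count-∨ : ∀ n {P Q R : Fin n → Bool} → (∀ y → T (P y) → T (Q y) ⊎ T (R y)) →
            count n P ≤ count n Q + count n R
  count-∨ zero    _ = z≤n
  count-∨ (suc n) {P} {Q} {R} P⇒Q∨R = begin
    fromBool (P zero) + count n _
      ≤⟨ +-mono-≤ (fromBool-∨ (P zero) (Q zero) (R zero) (P⇒Q∨R zero)) (count-∨ n (λ i → P⇒Q∨R (suc i))) ⟩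
    (fromBool (Q zero) + fromBool (R zero)) + (count n _ + count n _)
      ≡⟨ interchange (fromBool (Q zero)) (fromBool (R zero)) _ _ ⟩
    count (suc n) Q + count (suc n) R ∎
    where
    open ≤-Reasoning
    fromBool-∨ : ∀ p q r → (T p → T q ⊎ T r) → fromBool p ≤ fromBool q + fromBool r
    fromBool-∨ false _     _     _     = z≤n
    fromBool-∨ true  true  _     _     = s≤s z≤n
    fromBool-∨ true  false true  _     = s≤s z≤n
    fromBool-∨ true  false false p⇒q∨r with p⇒q∨r _
    ... | inj₁ ()
    ... | inj₂ ()

  count-fiber≤1 : ∀ n (f : Fin n → ℕ) → Injective _≡_ _≡_ f → ∀ w → count n (λ y → does (f y ≟ w)) ≤ 1
  count-fiber≤1 zero    f f-inj w = z≤n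
  count-fiber≤1 (suc n) f f-inj w with f zero ≟ w
  ... | yes f0≡w rewrite dec-true (f zero ≟ w) f0≡w =
    ≤-reflexive (cong suc (count-false n (λ i → dec-false (f (suc i) ≟ w) (fi≢w i))))
    where
    fi≢w : ∀ i → f (suc i) ≢ w
    fi≢w i fi≡w = Fin.0≢1+n (f-inj (trans f0≡w (sym fi≡w)))
  ... | no  f0≢w rewrite dec-false (f zero ≟ w) f0≢w =
    count-fiber≤1 n (λ i → f (suc i)) (λ e → Fin.suc-injective (f-inj e)) w

  count-≤-injective : ∀ n (f : Fin n → ℕ) → Injective _≡_ _≡_ f → (∀ y → 1 ≤ f y) →
                      ∀ V → count n (λ y → does (f y ≤? V)) ≤ V
  count-≤-injective n f f-inj f≥1 zero =
    ≤-reflexive (count-false n (λ y → dec-false (f y ≤? 0) (<⇒≱ (f≥1 y))))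
  count-≤-injective n f f-inj f≥1 (suc V) = begin
    count n (λ y → does (f y ≤? suc V))
      ≤⟨ count-∨ n split ⟩
    count n (λ y → does (f y ≤? V)) + count n (λ y → does (f y ≟ suc V))
      ≤⟨ +-mono-≤ (count-≤-injective n f f-inj f≥1 V) (count-fiber≤1 n f f-inj (suc V)) ⟩
    V + 1
      ≡⟨ +-comm V 1 ⟩
    suc V ∎
    where
    open ≤-Reasoning
    split : ∀ y → T (f y ≤ᵇ suc V) → T (f y ≤ᵇ V) ⊎ T (f y ≡ᵇ suc V)
    split y fy≤1+V with f y ≤? V
    ... | yes fy≤V = inj₁ (≤⇒≤ᵇ fy≤V)
    ... | no  fy≰V = inj₂ (≡⇒≡ᵇ (f y) (suc V) (≤-antisym (≤ᵇ⇒≤ (f y) (suc V) fy≤1+V) (≰⇒> fy≰V)))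

module _ where
  import Data.Nat as ℕ
  import Data.Nat.Properties as ℕ
  open import Data.Integer as ℤ using (+_)
  import Data.Integer.Properties as ℤ
  open import Data.Rational
  open import Data.Rational.Properties
  import Data.Rational.Unnormalised as ℚᵘ
  import Data.Rational.Unnormalised.Properties as ℚᵘ
  open import Data.Bool using (true; false; if_then_else_)
  import Data.Nat.Coprimality as Coprimality
  open import Relation.Binary.PropositionalEquality

  private
    ℕ→ℚ≡mkℚ : ∀ a → ℕ→ℚ a ≡ mkℚ (+ a) 0 (Coprimality.sym (Coprimality.1-coprimeTo a))
    ℕ→ℚ≡mkℚ a = ↥p/↧p≡p (mkℚ (+ a) 0 (Coprimality.sym (Coprimality.1-coprimeTo a)))

  ℕ→ℚ-+ : ∀ a b → ℕ→ℚ (a ℕ.+ b) ≡ ℕ→ℚ a + ℕ→ℚ b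
  ℕ→ℚ-+ a b rewrite ℕ→ℚ≡mkℚ a | ℕ→ℚ≡mkℚ b =
    /-cong (sym (cong₂ ℤ._+_ (ℤ.*-identityʳ (+ a)) (ℤ.*-identityʳ (+ b)))) refl

  ℕ→ℚ-* : ∀ a b → ℕ→ℚ (a ℕ.* b) ≡ ℕ→ℚ a * ℕ→ℚ b
  ℕ→ℚ-* a b rewrite ℕ→ℚ≡mkℚ a | ℕ→ℚ≡mkℚ b = /-cong (ℤ.pos-* a b) refl

  ℕ→ℚ-mono-≤ : ∀ {a b} → a ℕ.≤ b → ℕ→ℚ a ≤ ℕ→ℚ b
  ℕ→ℚ-mono-≤ {a} {b} a≤b rewrite ℕ→ℚ≡mkℚ a | ℕ→ℚ≡mkℚ b =
    *≤* (subst₂ ℤ._≤_ (sym (ℤ.*-identityʳ (+ a))) (sym (ℤ.*-identityʳ (+ b))) (ℤ.+≤+ a≤b))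

  0≤ℕ→ℚ : ∀ a → 0ℚ ≤ ℕ→ℚ a
  0≤ℕ→ℚ a = ℕ→ℚ-mono-≤ {0} {a} ℕ.z≤n

  +a/2≡ℕ→ℚa*½ : ∀ a → (+ a) / 2 ≡ ℕ→ℚ a * ½
  +a/2≡ℕ→ℚa*½ a rewrite ℕ→ℚ≡mkℚ a = /-cong (sym (ℤ.*-identityʳ (+ a))) refl

  +a/-antimonoʳ : ∀ a {m n} → m ℕ.≤ n → (+ a) / ℕ.suc n ≤ (+ a) / ℕ.suc m
  +a/-antimonoʳ a {m} {n} m≤n = toℚᵘ-cancel-≤
    (ℚᵘ.≤-respʳ-≃ (ℚᵘ.≃-sym (toℚᵘ-fromℚᵘ (ℚᵘ.mkℚᵘ (+ a) m)))
      (ℚᵘ.≤-respˡ-≃ (ℚᵘ.≃-sym (toℚᵘ-fromℚᵘ (ℚᵘ.mkℚᵘ (+ a) n)))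
        (ℚᵘ.*≤* (subst₂ ℤ._≤_ (ℤ.pos-* a (ℕ.suc m)) (ℤ.pos-* a (ℕ.suc n))
                   (ℤ.+≤+ (ℕ.*-monoʳ-≤ a (ℕ.s≤s m≤n)))))))

  0≤+ : ∀ {p q} → 0ℚ ≤ p → 0ℚ ≤ q → 0ℚ ≤ p + q
  0≤+ 0≤p 0≤q = ≤-trans (≤-reflexive (sym (+-identityˡ 0ℚ))) (+-mono-≤ 0≤p 0≤q)

  0≤* : ∀ {p q} → 0ℚ ≤ p → 0ℚ ≤ q → 0ℚ ≤ p * q
  0≤* {p} 0≤p 0≤q = ≤-trans (≤-reflexive (sym (*-zeroʳ p))) (*-monoˡ-≤-nonNeg p {{nonNegative 0≤p}} 0≤q)

  0≤if : ∀ {q} c → 0ℚ ≤ q → 0ℚ ≤ (if c then q else 0ℚ)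
  0≤if true  0≤q = 0≤q
  0≤if false _   = ≤-refl

  *-monoˡ-≤-0≤ : ∀ {r p q} → 0ℚ ≤ r → p ≤ q → r * p ≤ r * q
  *-monoˡ-≤-0≤ {r} 0≤r = *-monoˡ-≤-nonNeg r {{nonNegative 0≤r}}

  p≤p+q : ∀ {p q} → 0ℚ ≤ q → p ≤ p + q
  p≤p+q {p} 0≤q = ≤-trans (≤-reflexive (sym (+-identityʳ p))) (+-monoʳ-≤ p 0≤q)

  p-q≤p : ∀ {p q} → 0ℚ ≤ q → p - q ≤ p
  p-q≤p {p} 0≤q = ≤-trans (+-monoʳ-≤ p (neg-antimono-≤ 0≤q)) (≤-reflexive (+-identityʳ p))

  p≤q⇒0≤q-p : ∀ {p q} → p ≤ q → 0ℚ ≤ q - p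
  p≤q⇒0≤q-p {p} p≤q = ≤-trans (≤-reflexive (sym (+-inverseʳ p))) (+-monoˡ-≤ (- p) p≤q)

  ≤-by-difference : ∀ {p q} e → 0ℚ ≤ e → q ≡ p + e → p ≤ q
  ≤-by-difference {p} e 0≤e q≡p+e = ≤-trans (p≤p+q 0≤e) (≤-reflexive (sym q≡p+e))

module _ where
  import Data.Nat as ℕ
  open import Data.Fin using (zero; suc)
  import Data.Fin.Properties as Fin
  open import Data.Bool using (Bool; true; false; if_then_else_)
  open import Data.Rational using (ℚ; 0ℚ; _≤_; _+_; _*_; _-_)
  open import Data.Rational.Properties
  open import Data.Rational.Solver using (module +-*-Solver)
  open +-*-Solver
  open import Relation.Binary.PropositionalEquality
  open import Relation.Nullary using (does)

  sumFin-mono : ∀ n {f g : Fin n → ℚ} → (∀ y → f y ≤ g y) → sumFin n f ≤ sumFin n g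
  sumFin-mono ℕ.zero    f≤g = ≤-refl
  sumFin-mono (ℕ.suc n) f≤g = +-mono-≤ (f≤g zero) (sumFin-mono n (λ i → f≤g (suc i)))

  sumFin-+ : ∀ n (f g : Fin n → ℚ) → sumFin n (λ y → f y + g y) ≡ sumFin n f + sumFin n g
  sumFin-+ ℕ.zero    f g = refl
  sumFin-+ (ℕ.suc n) f g = trans (cong (f zero + g zero +_) (sumFin-+ n (λ i → f (suc i)) (λ i → g (suc i))))
    (solve 4 (λ a b A B → (a :+ b) :+ (A :+ B) := (a :+ A) :+ (b :+ B)) refl
      (f zero) (g zero) (sumFin n (λ i → f (suc i))) (sumFin n (λ i → g (suc i))))

  sumFin-- : ∀ n (f g : Fin n → ℚ) → sumFin n (λ y → f y - g y) ≡ sumFin n f - sumFin n g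
  sumFin-- ℕ.zero    f g = refl
  sumFin-- (ℕ.suc n) f g = trans (cong (f zero - g zero +_) (sumFin-- n (λ i → f (suc i)) (λ i → g (suc i))))
    (solve 4 (λ a b A B → (a :- b) :+ (A :- B) := (a :+ A) :- (b :+ B)) refl
      (f zero) (g zero) (sumFin n (λ i → f (suc i))) (sumFin n (λ i → g (suc i))))

  sumFin-0 : ∀ n → sumFin n (λ _ → 0ℚ) ≡ 0ℚ
  sumFin-0 ℕ.zero    = refl
  sumFin-0 (ℕ.suc n) = trans (+-identityˡ _) (sumFin-0 n)

  sumFin-single : ∀ n (z : Fin n) c → sumFin n (λ y → if does (y Fin.≟ z) then c else 0ℚ) ≡ c
  sumFin-single (ℕ.suc n) zero    c = trans (cong (c +_) (sumFin-0 n)) (+-identityʳ c)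
  sumFin-single (ℕ.suc n) (suc z) c = trans (+-identityˡ _) (sumFin-single n z c)

  sumFin-if : ∀ n (P : Fin n → Bool) c → sumFin n (λ y → if P y then c else 0ℚ) ≡ c * ℕ→ℚ (count n P)
  sumFin-if ℕ.zero    P c = sym (*-zeroʳ c)
  sumFin-if (ℕ.suc n) P c = begin
    (if P zero then c else 0ℚ) + sumFin n (λ i → if P (suc i) then c else 0ℚ)
      ≡⟨ cong₂ _+_ (if-as-* (P zero)) (sumFin-if n (λ i → P (suc i)) c) ⟩
    c * ℕ→ℚ (fromBool (P zero)) + c * ℕ→ℚ (count n (λ i → P (suc i)))
      ≡⟨ *-distribˡ-+ c _ _ ⟨
    c * (ℕ→ℚ (fromBool (P zero)) + ℕ→ℚ (count n (λ i → P (suc i))))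
      ≡⟨ cong (c *_) (ℕ→ℚ-+ (fromBool (P zero)) _) ⟨
    c * ℕ→ℚ (count (ℕ.suc n) P) ∎
    where
    open ≡-Reasoning
    if-as-* : ∀ b → (if b then c else 0ℚ) ≡ c * ℕ→ℚ (fromBool b)
    if-as-* true  = sym (*-identityʳ c)
    if-as-* false = sym (*-zeroʳ c)

module _ where
  open import Data.Nat as ℕ using (_<_; _<?_; suc)
  import Data.Nat.Properties as ℕ
  import Data.Fin.Properties as Fin
  open import Data.Bool.Properties using (∧-zeroʳ)
  open import Data.Rational using (ℚ; 0ℚ; _+_)
  open import Data.List using (List)
  open import Data.List.Membership.Propositional using (_∈_; _∉_)
  import Data.List.Membership.DecPropositional as DecMem
  open import Relation.Binary.PropositionalEquality
  open import Relation.Nullary using (yes; no; ¬_; does)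
  open import Relation.Nullary.Decidable using (dec-true; dec-false)

  module _ {n} (π : Fin n → ℕ) {z : Fin n} where

    fetchPos-self : fetchPos π z z ≡ 1
    fetchPos-self rewrite dec-true (z Fin.≟ z) refl = refl

    fetchPos-before : ∀ {y} → y ≢ z → π y < π z → fetchPos π z y ≡ suc (π y)
    fetchPos-before {y} y≢z πy<πz rewrite dec-false (y Fin.≟ z) y≢z | dec-true (π y <? π z) πy<πz = refl

    fetchPos-after : ∀ {y} → y ≢ z → ¬ π y < π z → fetchPos π z y ≡ π y
    fetchPos-after {y} y≢z πy≮πz rewrite dec-false (y Fin.≟ z) y≢z | dec-false (π y <? π z) πy≮πz = refl

    fetchPos-≥ : ∀ {y} → y ≢ z → π y ℕ.≤ fetchPos π z y
    fetchPos-≥ {y} y≢z with π y <? π z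
    ... | yes πy<πz = ℕ.≤-trans (ℕ.n≤1+n (π y)) (ℕ.≤-reflexive (sym (fetchPos-before y≢z πy<πz)))
    ... | no  πy≮πz = ℕ.≤-reflexive (sym (fetchPos-after y≢z πy≮πz))

  module _ {n} (s : State n) {z : Fin n} where

    fetch-budget-self : budget (fetch s z) z ≡ 0ℚ
    fetch-budget-self rewrite dec-true (z Fin.≟ z) refl = refl

    fetch-budget-other : ∀ {y} → y ≢ z → budget (fetch s z) y ≡ budget s y
    fetch-budget-other {y} y≢z rewrite dec-false (y Fin.≟ z) y≢z = refl

  module _ {n} (R : List (Fin n)) (x : Fin n) (inc : ℚ) (b : Fin n → ℚ) where
    open DecMem (Fin._≟_ {n}) using (_∈?_)

    bump-self : bump R x inc b x ≡ b x
    bump-self rewrite dec-true (x Fin.≟ x) refl | ∧-zeroʳ (does (x ∈? R)) = refl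

    bump-∈ : ∀ {y} → y ∈ R → y ≢ x → bump R x inc b y ≡ b y + inc
    bump-∈ {y} y∈R y≢x rewrite dec-true (y ∈? R) y∈R | dec-false (y Fin.≟ x) y≢x = refl

    bump-∉ : ∀ {y} → y ∉ R → bump R x inc b y ≡ b y
    bump-∉ {y} y∉R rewrite dec-false (y ∈? R) y∉R = refl

-- Budgets of reachable states

module _ where
  import Data.Nat as ℕ
  import Data.Nat.Properties as ℕ
  import Data.Fin.Properties as Fin
  open import Data.Rational using (ℚ; 0ℚ; ½; _≤_; _+_; _*_; _-_)
  open import Data.Rational.Properties
  open import Data.Rational.Solver using (module +-*-Solver)
  open +-*-Solver
  open import Data.List using (List; _∷_; length)
  open import Data.List.Membership.Propositional using (_∈_)
  open import Data.List.Relation.Unary.Any using (here; there)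
  open import Data.List.Relation.Unary.All as All using (All)
  import Data.List.Membership.DecPropositional as DecMem
  open import Data.Product using (_×_; _,_; proj₁)
  open import Relation.Binary.PropositionalEquality
  open import Relation.Nullary using (Dec; yes; no)
  open import Relation.Nullary.Negation using (contradiction)

  private
    2≤length : ∀ {A : Set} {x y : A} {L : List A} → x ∈ L → y ∈ L → y ≢ x → 2 ℕ.≤ length L
    2≤length (here refl)            (here refl)            y≢x = contradiction refl y≢x
    2≤length (here _)               (there {xs = _ ∷ _} _) _   = ℕ.s≤s (ℕ.s≤s ℕ.z≤n)
    2≤length (there {xs = _ ∷ _} _) (here _)               _   = ℕ.s≤s (ℕ.s≤s ℕ.z≤n)
    2≤length (there x∈L)            (there y∈L)            y≢x = ℕ.m≤n⇒m≤1+n (2≤length x∈L y∈L y≢x)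

    0≤ratio : ∀ ℓ m (1≤m : 1 ℕ.≤ m) → 0ℚ ≤ ratio ℓ m 1≤m
    0≤ratio ℓ (ℕ.suc m) _ = nonNegative⁻¹ _ {{normalize-nonNeg ℓ (ℕ.suc m)}}

    ratio≤half : ∀ ℓ m (1≤m : 1 ℕ.≤ m) → 2 ℕ.≤ m → ratio ℓ m 1≤m ≤ ℕ→ℚ ℓ * ½
    ratio≤half ℓ (ℕ.suc ℕ.zero)    _ (ℕ.s≤s ())
    ratio≤half ℓ (ℕ.suc (ℕ.suc m)) _ _ =
      ≤-trans (+a/-antimonoʳ ℓ (ℕ.s≤s ℕ.z≤n)) (≤-reflexive (+a/2≡ℕ→ℚa*½ ℓ))

    2[b+i]≤3p′ : ∀ {b i p p′} → b ≤ p → i ≤ p * ½ → p ≤ p′ → ℕ→ℚ 2 * (b + i) ≤ ℕ→ℚ 3 * p′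
    2[b+i]≤3p′ {b} {i} {p} {p′} b≤p i≤p/2 p≤p′ =
      ≤-by-difference (ℕ→ℚ 2 * (p - b) + ℕ→ℚ 2 * (p * ½ - i) + ℕ→ℚ 3 * (p′ - p))
        (0≤+ (0≤+ (0≤* (0≤ℕ→ℚ 2) (p≤q⇒0≤q-p b≤p)) (0≤* (0≤ℕ→ℚ 2) (p≤q⇒0≤q-p i≤p/2)))
             (0≤* (0≤ℕ→ℚ 3) (p≤q⇒0≤q-p p≤p′)))
        (solve 4 (λ b i p p′ → con (ℕ→ℚ 3) :* p′ := con (ℕ→ℚ 2) :* (b :+ i) :+
           (con (ℕ→ℚ 2) :* (p :- b) :+ con (ℕ→ℚ 2) :* (p :* con ½ :- i) :+ con (ℕ→ℚ 3) :* (p′ :- p))) refl b i p p′)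

  -- A request raises b(y) by ℓ/s ≤ π(y)/2 (s ≥ 2 as y ≠ x), so budgets at most π grow to at most 3π/2.
  Bounded : Phase → ℚ → ℕ → Set
  Bounded between b k = 0ℚ ≤ b × b ≤ ℕ→ℚ k
  Bounded inLoop  b k = 0ℚ ≤ b × ℕ→ℚ 2 * b ≤ ℕ→ℚ 3 * ℕ→ℚ k

  private
    reset-bounded : ∀ {b} k → b ≡ 0ℚ → Bounded inLoop b k
    reset-bounded k refl = ≤-refl , ≤-trans (≤-reflexive (*-zeroʳ (ℕ→ℚ 2))) (0≤* (0≤ℕ→ℚ 3) (0≤ℕ→ℚ k))

  module _ {n : ℕ} where
    open DecMem (Fin._≟_ {n}) using (_∈?_)

    private
      fetch-bounded : ∀ (s : State n) z y → Dec (y ≡ z) → Bounded inLoop (budget s y) (pos s y) →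
                      Bounded inLoop (budget (fetch s z) y) (pos (fetch s z) y)
      fetch-bounded s z y (yes refl) _ = reset-bounded (pos (fetch s y) y) (fetch-budget-self s)
      fetch-bounded s z y (no y≢z) (0≤b , 2b≤3π) =
        subst (λ b′ → Bounded inLoop b′ (pos (fetch s z) y)) (sym (fetch-budget-other s y≢z))
          (0≤b , ≤-trans 2b≤3π (*-monoˡ-≤-0≤ (0≤ℕ→ℚ 3) (ℕ→ℚ-mono-≤ (fetchPos-≥ (pos s) y≢z))))

      serve-bounded : ∀ {r} (s : State n) (R : Request n r) {x} → x ∈ elems R →
                      All (λ y → pos s x ℕ.≤ pos s y) (elems R) →
                      ∀ y → Dec (y ≡ x) → Dec (y ∈ elems R) → Bounded between (budget s y) (pos s y) →
                      Bounded inLoop (budget (serve s R x) y) (pos (serve s R x) y)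
      serve-bounded s R _ _ y (yes refl) _ _ =
        reset-bounded (pos (serve s R y) y)
          (trans (bump-self (elems R) y (ratio (pos s y) (card R) (card≥1 R)) (budget (fetch s y)))
                 (fetch-budget-self s))
      serve-bounded s R {x} x∈R x-first y (no y≢x) (yes y∈R) (0≤b , b≤π) =
        subst (λ b′ → Bounded inLoop b′ (pos (serve s R x) y)) (sym b′≡b+inc)
          (0≤+ 0≤b (0≤ratio (pos s x) (card R) (card≥1 R)) ,
           2[b+i]≤3p′ b≤π inc≤πy/2 (ℕ→ℚ-mono-≤ (fetchPos-≥ (pos s) y≢x)))
        where
        inc = ratio (pos s x) (card R) (card≥1 R)
        b′≡b+inc : budget (serve s R x) y ≡ budget s y + inc
        b′≡b+inc = trans (bump-∈ (elems R) x inc (budget (fetch s x)) y∈R y≢x)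
                         (cong (_+ inc) (fetch-budget-other s y≢x))
        inc≤πy/2 : inc ≤ ℕ→ℚ (pos s y) * ½
        inc≤πy/2 = ≤-trans (ratio≤half (pos s x) (card R) (card≥1 R) (2≤length x∈R y∈R y≢x))
                           (*-monoʳ-≤-nonNeg ½ (ℕ→ℚ-mono-≤ (All.lookup x-first y∈R)))
      serve-bounded s R {x} _ _ y (no y≢x) (no y∉R) (0≤b , b≤π) =
        subst (λ b′ → Bounded inLoop b′ (pos (serve s R x) y)) (sym b′≡b)
          (0≤b , subst (λ b″ → ℕ→ℚ 2 * b″ ≤ ℕ→ℚ 3 * ℕ→ℚ (pos (serve s R x) y)) (+-identityʳ (budget s y))
                       (2[b+i]≤3p′ b≤π (0≤* (0≤ℕ→ℚ (pos s y)) (nonNegative⁻¹ ½))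
                          (ℕ→ℚ-mono-≤ (fetchPos-≥ (pos s) y≢x))))
        where
        b′≡b : budget (serve s R x) y ≡ budget s y
        b′≡b = trans (bump-∉ (elems R) x (ratio (pos s x) (card R) (card≥1 R)) (budget (fetch s x)) y∉R)
                     (fetch-budget-other s y≢x)

    reach⇒bounded : ∀ {r ph} {s : State n} → Reach r ph s → ∀ y → Bounded ph (budget s y) (pos s y)
    reach⇒bounded (init π₀ _)                     y = ≤-refl , 0≤ℕ→ℚ (π₀ y)
    reach⇒bounded (done reach b<π)                y = proj₁ (reach⇒bounded reach y) , <⇒≤ (b<π y)
    reach⇒bounded (loop {s} reach z _)            y = fetch-bounded s z y (y Fin.≟ z) (reach⇒bounded reach y)
    reach⇒bounded (req {s} reach R x x∈R x-first) y =
      serve-bounded s R x∈R x-first y (y Fin.≟ x) (y ∈? elems R) (reach⇒bounded reach y)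

-- Potentials of a single element

module _ where
  open import Data.Nat as ℕ using (suc)
  import Data.Nat.Properties as ℕ
  open import Data.Nat.Logarithm using (⌊log₂⌋-mono-≤)
  open import Data.Rational using (ℚ; 0ℚ; ½; _≤_; _+_; _*_; _-_; -_; nonNegative)
  open import Data.Rational.Properties
  open import Data.Rational.Solver using (module +-*-Solver)
  open +-*-Solver
  open import Data.Bool using (if_then_else_)
  open import Data.Sum using ([_,_]′)
  open import Relation.Binary.PropositionalEquality
  open import Relation.Nullary using (does)
  open import Relation.Nullary.Decidable using (dec-true; dec-false)

  -- Φ_z and Ψ_z for an element at position j with budget b, where P = p*(z) + κ.
  φ : ℕ → ℕ → ℕ → ℚ → ℚ
  φ r P j b = if does (pexp j ℕ.≤? P) then αc * b else βc r * ℕ→ℚ j - γc r * b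

  ψ : ℕ → ℕ → ℕ → ℚ
  ψ r P j = if does (pexp j ℕ.<? P) then 0ℚ else ℕ→ℚ 2 * βc r * ℕ→ℚ (qrem j)

  Δ : ℕ → ℕ → ℕ → ℕ → ℚ → ℚ → ℚ
  Δ r P j j′ b b′ = (φ r P j′ b′ - φ r P j b) + (ψ r P j′ - ψ r P j)

  0≤β : ∀ r → 0ℚ ≤ βc r
  0≤β r = nonNegative⁻¹ (βc r) {{normalize-nonNeg (15 ℕ.* r ℕ.+ 10) 2}}

  β≡ : ∀ r → βc r ≡ (ℕ→ℚ 15 * ℕ→ℚ r + ℕ→ℚ 10) * ½
  β≡ r = trans (+a/2≡ℕ→ℚa*½ (15 ℕ.* r ℕ.+ 10))
               (cong (_* ½) (trans (ℕ→ℚ-+ (15 ℕ.* r) 10) (cong (_+ ℕ→ℚ 10) (ℕ→ℚ-* 15 r))))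

  3β*c≤k : ∀ r c k → (45 ℕ.* r ℕ.+ 30) ℕ.* c ℕ.≤ 2 ℕ.* k → ℕ→ℚ 3 * βc r * ℕ→ℚ c ≤ ℕ→ℚ k
  3β*c≤k r c k 6βc≤2k = ≤-by-difference (½ * (ℕ→ℚ 2 * K - (ℕ→ℚ 45 * R + ℕ→ℚ 30) * C))
    (0≤* (nonNegative⁻¹ ½) (p≤q⇒0≤q-p 6βc≤2k′))
    (trans (solve 3 (λ R C K → K := con (ℕ→ℚ 3) :* ((con (ℕ→ℚ 15) :* R :+ con (ℕ→ℚ 10)) :* con ½) :* C
                                    :+ con ½ :* (con (ℕ→ℚ 2) :* K :- (con (ℕ→ℚ 45) :* R :+ con (ℕ→ℚ 30)) :* C)) refl R C K)
           (cong (λ β → ℕ→ℚ 3 * β * C + ½ * (ℕ→ℚ 2 * K - (ℕ→ℚ 45 * R + ℕ→ℚ 30) * C)) (sym (β≡ r))))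
    where
    R = ℕ→ℚ r
    C = ℕ→ℚ c
    K = ℕ→ℚ k
    6βc≤2k′ : (ℕ→ℚ 45 * R + ℕ→ℚ 30) * C ≤ ℕ→ℚ 2 * K
    6βc≤2k′ = subst₂ _≤_
      (trans (ℕ→ℚ-* (45 ℕ.* r ℕ.+ 30) c) (cong (_* C) (trans (ℕ→ℚ-+ (45 ℕ.* r) 30) (cong (_+ ℕ→ℚ 30) (ℕ→ℚ-* 45 r)))))
      (ℕ→ℚ-* 2 k) (ℕ→ℚ-mono-≤ 6βc≤2k)

  private
    [p-p]+[q-q]≡0 : ∀ p q → (p - p) + (q - q) ≡ 0ℚ
    [p-p]+[q-q]≡0 p q = trans (cong₂ _+_ (+-inverseʳ p) (+-inverseʳ q)) (+-identityˡ 0ℚ)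

  Δ-unchanged : ∀ r P j b → Δ r P j j b b ≡ 0ℚ
  Δ-unchanged r P j b = [p-p]+[q-q]≡0 (φ r P j b) (ψ r P j)

  module _ (r P : ℕ) where

    φ-low : ∀ {j b} → pexp j ℕ.≤ P → φ r P j b ≡ αc * b
    φ-low {j} {b} p≤P = cong (if_then αc * b else βc r * ℕ→ℚ j - γc r * b) (dec-true (pexp j ℕ.≤? P) p≤P)

    φ-high : ∀ {j b} → P ℕ.< pexp j → φ r P j b ≡ βc r * ℕ→ℚ j - γc r * b
    φ-high {j} {b} P<p = cong (if_then αc * b else βc r * ℕ→ℚ j - γc r * b) (dec-false (pexp j ℕ.≤? P) (ℕ.<⇒≱ P<p))

    ψ-low : ∀ {j} → pexp j ℕ.< P → ψ r P j ≡ 0ℚ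
    ψ-low {j} p<P = cong (if_then 0ℚ else ℕ→ℚ 2 * βc r * ℕ→ℚ (qrem j)) (dec-true (pexp j ℕ.<? P) p<P)

    ψ-high : ∀ {j} → P ℕ.≤ pexp j → ψ r P j ≡ ℕ→ℚ 2 * βc r * ℕ→ℚ (qrem j)
    ψ-high {j} P≤p = cong (if_then 0ℚ else ℕ→ℚ 2 * βc r * ℕ→ℚ (qrem j)) (dec-false (pexp j ℕ.<? P) (ℕ.≤⇒≯ P≤p))

    ψ-qrem≡0 : ∀ {j} → qrem j ≡ 0 → ψ r P j ≡ 0ℚ
    ψ-qrem≡0 {j} q≡0 =
      [ ψ-low {j}
      , (λ P≤p → trans (ψ-high {j} P≤p) (trans (cong (λ q → ℕ→ℚ 2 * βc r * ℕ→ℚ q) q≡0) (*-zeroʳ (ℕ→ℚ 2 * βc r))))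
      ]′ (ℕ.<-≤-connex (pexp j) P)

    0≤ψ : ∀ j → 0ℚ ≤ ψ r P j
    0≤ψ j =
      [ (λ p<P → ≤-reflexive (sym (ψ-low {j} p<P)))
      , (λ P≤p → ≤-trans (0≤* (0≤* (0≤ℕ→ℚ 2) (0≤β r)) (0≤ℕ→ℚ (qrem j))) (≤-reflexive (sym (ψ-high {j} P≤p))))
      ]′ (ℕ.<-≤-connex (pexp j) P)

    φ≥2k : ∀ {k b} → ℕ→ℚ k ≤ b → ℕ→ℚ 2 * b ≤ ℕ→ℚ 3 * ℕ→ℚ k → ℕ→ℚ 2 * ℕ→ℚ k ≤ φ r P k b
    φ≥2k {k} {b} k≤b 2b≤3k =
      [ (λ p≤P → ≤-trans (*-monoˡ-≤-0≤ (0≤ℕ→ℚ 2) k≤b) (≤-reflexive (sym (φ-low {k} {b} p≤P))))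
      , (λ P<p → ≤-trans (≤-by-difference e 0≤e βk-γb≡2k+e) (≤-reflexive (sym (φ-high {k} {b} P<p))))
      ]′ (ℕ.≤-<-connex (pexp k) P)
      where
      R = ℕ→ℚ r
      K = ℕ→ℚ k
      e = ℕ→ℚ 5 * R * ½ * (ℕ→ℚ 3 * K - ℕ→ℚ 2 * b) + ℕ→ℚ 3 * K
      0≤e : 0ℚ ≤ e
      0≤e = 0≤+ (0≤* (0≤* (0≤* (0≤ℕ→ℚ 5) (0≤ℕ→ℚ r)) (nonNegative⁻¹ ½)) (p≤q⇒0≤q-p 2b≤3k))
                (0≤* (0≤ℕ→ℚ 3) (0≤ℕ→ℚ k))
      βk-γb≡2k+e : βc r * K - γc r * b ≡ ℕ→ℚ 2 * K + e
      βk-γb≡2k+e = trans (cong₂ (λ β γ → β * K - γ * b) (β≡ r) (ℕ→ℚ-* 5 r))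
        (solve 3 (λ R K b → (con (ℕ→ℚ 15) :* R :+ con (ℕ→ℚ 10)) :* con ½ :* K :- con (ℕ→ℚ 5) :* R :* b
                          := con (ℕ→ℚ 2) :* K :+ (con (ℕ→ℚ 5) :* R :* con ½ :* (con (ℕ→ℚ 3) :* K :- con (ℕ→ℚ 2) :* b)
                                                 :+ con (ℕ→ℚ 3) :* K)) refl R K b)

    Δ-fetched : ∀ {k b} → ℕ→ℚ k ≤ b → ℕ→ℚ 2 * b ≤ ℕ→ℚ 3 * ℕ→ℚ k → Δ r P k 1 b 0ℚ ≤ - (ℕ→ℚ 2 * ℕ→ℚ k)
    Δ-fetched {k} {b} k≤b 2b≤3k = begin
      Δ r P k 1 b 0ℚ                    ≡⟨ cong₂ (λ u v → (u - φ r P k b) + (v - ψ r P k)) φ₁≡0 (ψ-qrem≡0 {1} refl) ⟩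
      (0ℚ - φ r P k b) + (0ℚ - ψ r P k) ≡⟨ solve 2 (λ f g → (con 0ℚ :- f) :+ (con 0ℚ :- g) := :- (f :+ g)) refl
                                                  (φ r P k b) (ψ r P k) ⟩
      - (φ r P k b + ψ r P k)           ≤⟨ neg-antimono-≤ 2k≤φ+ψ ⟩
      - (ℕ→ℚ 2 * ℕ→ℚ k)                 ∎
      where
      open ≤-Reasoning
      φ₁≡0 : φ r P 1 0ℚ ≡ 0ℚ
      φ₁≡0 = trans (φ-low {1} {0ℚ} ℕ.z≤n) (*-zeroʳ αc)
      2k≤φ+ψ : ℕ→ℚ 2 * ℕ→ℚ k ≤ φ r P k b + ψ r P k
      2k≤φ+ψ = ≤-trans (≤-reflexive (sym (+-identityʳ (ℕ→ℚ 2 * ℕ→ℚ k)))) (+-mono-≤ (φ≥2k {k} {b} k≤b 2b≤3k) (0≤ψ k))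

    Δ-below : ∀ {j b} → pexp (suc j) ℕ.< P → Δ r P j (suc j) b b ≡ 0ℚ
    Δ-below {j} {b} p′<P =
      trans (cong₂ _+_ (cong₂ _-_ (φ-low {suc j} (ℕ.<⇒≤ p′<P)) (φ-low {j} (ℕ.<⇒≤ p<P)))
                       (cong₂ _-_ (ψ-low {suc j} p′<P) (ψ-low {j} p<P)))
            ([p-p]+[q-q]≡0 (αc * b) 0ℚ)
      where p<P = ℕ.≤-<-trans (⌊log₂⌋-mono-≤ (ℕ.n≤1+n j)) p′<P

    private
      φ-step-low : ∀ {j b} → pexp (suc j) ℕ.≤ P → φ r P (suc j) b - φ r P j b ≡ 0ℚ
      φ-step-low {j} {b} p′≤P =
        trans (cong₂ _-_ (φ-low {suc j} p′≤P) (φ-low {j} (ℕ.≤-trans (⌊log₂⌋-mono-≤ (ℕ.n≤1+n j)) p′≤P)))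
              (+-inverseʳ (αc * b))

      φ-step-high : ∀ {j b} → P ℕ.< pexp j → φ r P (suc j) b - φ r P j b ≡ βc r
      φ-step-high {j} {b} P<p = begin
        φ r P (suc j) b - φ r P j b
          ≡⟨ cong₂ _-_ (φ-high {suc j} (ℕ.<-≤-trans P<p (⌊log₂⌋-mono-≤ (ℕ.n≤1+n j)))) (φ-high {j} P<p) ⟩
        (βc r * ℕ→ℚ (suc j) - γc r * b) - (βc r * ℕ→ℚ j - γc r * b)
          ≡⟨ cong (λ x → (βc r * x - γc r * b) - (βc r * ℕ→ℚ j - γc r * b)) (ℕ→ℚ-+ 1 j) ⟩
        (βc r * (ℕ→ℚ 1 + ℕ→ℚ j) - γc r * b) - (βc r * ℕ→ℚ j - γc r * b)
          ≡⟨ solve 4 (λ β γ J b → (β :* (con (ℕ→ℚ 1) :+ J) :- γ :* b) :- (β :* J :- γ :* b) := β) refl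
                     (βc r) (γc r) (ℕ→ℚ j) b ⟩
        βc r ∎
        where open ≡-Reasoning

      0≤2β : 0ℚ ≤ ℕ→ℚ 2 * βc r
      0≤2β = 0≤* (0≤ℕ→ℚ 2) (0≤β r)

    φ-step-same : ∀ {j b} → pexp (suc j) ≡ pexp j → φ r P (suc j) b - φ r P j b ≤ βc r
    φ-step-same {j} {b} p′≡p =
      [ (λ p≤P → ≤-trans (≤-reflexive (φ-step-low {j} {b} (subst (ℕ._≤ P) (sym p′≡p) p≤P))) (0≤β r))
      , (λ P<p → ≤-reflexive (φ-step-high {j} {b} P<p))
      ]′ (ℕ.≤-<-connex (pexp j) P)

    ψ-step-same : ∀ {j} → pexp (suc j) ≡ pexp j → qrem (suc j) ℕ.≤ suc (qrem j) →
                  ψ r P (suc j) - ψ r P j ≤ ℕ→ℚ 2 * βc r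
    ψ-step-same {j} p′≡p q′≤1+q = [ low , high ]′ (ℕ.<-≤-connex (pexp j) P)
      where
      open ≤-Reasoning
      low : pexp j ℕ.< P → ψ r P (suc j) - ψ r P j ≤ ℕ→ℚ 2 * βc r
      low p<P = begin
        ψ r P (suc j) - ψ r P j ≡⟨ cong₂ _-_ (ψ-low {suc j} (subst (ℕ._< P) (sym p′≡p) p<P)) (ψ-low {j} p<P) ⟩
        0ℚ - 0ℚ                 ≡⟨ +-inverseʳ 0ℚ ⟩
        0ℚ                      ≤⟨ 0≤2β ⟩
        ℕ→ℚ 2 * βc r            ∎
      high : P ℕ.≤ pexp j → ψ r P (suc j) - ψ r P j ≤ ℕ→ℚ 2 * βc r
      high P≤p = begin
        ψ r P (suc j) - ψ r P j   ≡⟨ cong₂ _-_ (ψ-high {suc j} (subst (P ℕ.≤_) (sym p′≡p) P≤p)) (ψ-high {j} P≤p) ⟩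
        B₂ * Q′ - B₂ * Q          ≤⟨ +-monoˡ-≤ (- (B₂ * Q)) (*-monoˡ-≤-0≤ 0≤2β Q′≤1+Q) ⟩
        B₂ * (ℕ→ℚ 1 + Q) - B₂ * Q ≡⟨ solve 2 (λ B Q → B :* (con (ℕ→ℚ 1) :+ Q) :- B :* Q := B) refl B₂ Q ⟩
        B₂                        ∎
        where
        B₂ = ℕ→ℚ 2 * βc r
        Q  = ℕ→ℚ (qrem j)
        Q′ = ℕ→ℚ (qrem (suc j))
        Q′≤1+Q : Q′ ≤ ℕ→ℚ 1 + Q
        Q′≤1+Q = subst (Q′ ≤_) (ℕ→ℚ-+ 1 (qrem j)) (ℕ→ℚ-mono-≤ q′≤1+q)

    φ-step-next : ∀ {j b} → 0ℚ ≤ b → pexp (suc j) ≡ suc (pexp j) → suc j ≡ 2 ℕ.* suc (qrem j) →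
                  φ r P (suc j) b - φ r P j b ≤ ℕ→ℚ 2 * βc r + ψ r P j
    φ-step-next {j} {b} 0≤b p′≡1+p sj≡2[1+q] =
      [ (λ p′≤P → ≤-trans (≤-reflexive (φ-step-low {j} {b} p′≤P)) (0≤+ 0≤2β (0≤ψ j)))
      , (λ P<p′ → [ crossing P<p′ , above ]′ (ℕ.≤-<-connex (pexp j) P))
      ]′ (ℕ.≤-<-connex (pexp (suc j)) P)
      where
      open ≤-Reasoning
      Q = ℕ→ℚ (qrem j)

      above : P ℕ.< pexp j → φ r P (suc j) b - φ r P j b ≤ ℕ→ℚ 2 * βc r + ψ r P j
      above P<p = begin
        φ r P (suc j) b - φ r P j b ≡⟨ φ-step-high {j} {b} P<p ⟩
        βc r                        ≤⟨ ≤-by-difference (βc r + ψ r P j) (0≤+ (0≤β r) (0≤ψ j))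
                                         (solve 2 (λ β ψ → con (ℕ→ℚ 2) :* β :+ ψ := β :+ (β :+ ψ)) refl (βc r) (ψ r P j)) ⟩
        ℕ→ℚ 2 * βc r + ψ r P j      ∎

      -- The new Φ-term β(j+1) = 2β(q+1) is paid for by the Ψ-term 2βq that disappears.
      crossing : P ℕ.< pexp (suc j) → pexp j ℕ.≤ P → φ r P (suc j) b - φ r P j b ≤ ℕ→ℚ 2 * βc r + ψ r P j
      crossing P<p′ p≤P = begin
        φ r P (suc j) b - φ r P j b
          ≡⟨ cong₂ _-_ (φ-high {suc j} P<p′) (φ-low {j} p≤P) ⟩
        (βc r * ℕ→ℚ (suc j) - γc r * b) - αc * b
          ≡⟨ cong (λ x → (βc r * x - γc r * b) - αc * b) 1+j≡2[1+q] ⟩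
        (βc r * (ℕ→ℚ 2 * (ℕ→ℚ 1 + Q)) - γc r * b) - αc * b
          ≡⟨ solve 5 (λ β γ α Q b → (β :* (con (ℕ→ℚ 2) :* (con (ℕ→ℚ 1) :+ Q)) :- γ :* b) :- α :* b
                                  := (con (ℕ→ℚ 2) :* β :+ con (ℕ→ℚ 2) :* β :* Q) :- (γ :+ α) :* b)
                     refl (βc r) (γc r) αc Q b ⟩
        (ℕ→ℚ 2 * βc r + ℕ→ℚ 2 * βc r * Q) - (γc r + αc) * b
          ≤⟨ p-q≤p (0≤* (0≤+ (0≤ℕ→ℚ (5 ℕ.* r)) (0≤ℕ→ℚ 2)) 0≤b) ⟩
        ℕ→ℚ 2 * βc r + ℕ→ℚ 2 * βc r * Q
          ≡⟨ cong (ℕ→ℚ 2 * βc r +_) (ψ-high {j} (ℕ.s≤s⁻¹ (subst (P ℕ.<_) p′≡1+p P<p′))) ⟨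
        ℕ→ℚ 2 * βc r + ψ r P j ∎
        where
        1+j≡2[1+q] : ℕ→ℚ (suc j) ≡ ℕ→ℚ 2 * (ℕ→ℚ 1 + Q)
        1+j≡2[1+q] = trans (cong ℕ→ℚ sj≡2[1+q]) (trans (ℕ→ℚ-* 2 (suc (qrem j))) (cong (ℕ→ℚ 2 *_) (ℕ→ℚ-+ 1 (qrem j))))

    Δ-shift≤3β : ∀ {j b} → 0ℚ ≤ b → Δ r P j (suc j) b b ≤ ℕ→ℚ 3 * βc r
    Δ-shift≤3β {j} {b} 0≤b = by-level (levelStep j)
      where
      open ≤-Reasoning
      by-level : LevelStep j → Δ r P j (suc j) b b ≤ ℕ→ℚ 3 * βc r
      by-level (same-level p′≡p q′≤1+q) = begin
        Δ r P j (suc j) b b ≤⟨ +-mono-≤ (φ-step-same {j} {b} p′≡p) (ψ-step-same {j} p′≡p q′≤1+q) ⟩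
        βc r + ℕ→ℚ 2 * βc r ≡⟨ solve 1 (λ β → β :+ con (ℕ→ℚ 2) :* β := con (ℕ→ℚ 3) :* β) refl (βc r) ⟩
        ℕ→ℚ 3 * βc r        ∎
      by-level (next-level p′≡1+p q′≡0 sj≡2[1+q]) = begin
        Δ r P j (suc j) b b
          ≡⟨ cong (λ x → (φ r P (suc j) b - φ r P j b) + (x - ψ r P j)) (ψ-qrem≡0 {suc j} q′≡0) ⟩
        (φ r P (suc j) b - φ r P j b) + (0ℚ - ψ r P j)
          ≤⟨ +-monoˡ-≤ (0ℚ - ψ r P j) (φ-step-next {j} {b} 0≤b p′≡1+p sj≡2[1+q]) ⟩
        (ℕ→ℚ 2 * βc r + ψ r P j) + (0ℚ - ψ r P j)
          ≡⟨ solve 2 (λ β ψ → (con (ℕ→ℚ 2) :* β :+ ψ) :+ (con 0ℚ :- ψ) := con (ℕ→ℚ 2) :* β) refl (βc r) (ψ r P j) ⟩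
        ℕ→ℚ 2 * βc r
          ≤⟨ *-monoʳ-≤-nonNeg (βc r) {{nonNegative (0≤β r)}} (ℕ→ℚ-mono-≤ {2} {3} (ℕ.s≤s (ℕ.s≤s ℕ.z≤n))) ⟩
        ℕ→ℚ 3 * βc r        ∎

module _ where
  import Data.Nat as ℕ
  open import Data.Rational using (_+_; _-_)
  open import Relation.Binary.PropositionalEquality

  ΔΦ+ΔΨ≡sumΔ : ∀ {n} r (s s′ : State n) (π* : Fin n → ℕ) →
               (Φ r s′ π* - Φ r s π*) + (Ψ r s′ π* - Ψ r s π*) ≡
               sumFin n (λ y → Δ r (pexp (π* y) ℕ.+ κc r) (pos s y) (pos s′ y) (budget s y) (budget s′ y))
  ΔΦ+ΔΨ≡sumΔ {n} r s s′ π* = begin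
    (Φ r s′ π* - Φ r s π*) + (Ψ r s′ π* - Ψ r s π*)
      ≡⟨ cong₂ _+_ (sumFin-- n (Φz r s′ π*) (Φz r s π*)) (sumFin-- n (Ψz r s′ π*) (Ψz r s π*)) ⟨
    sumFin n (λ y → Φz r s′ π* y - Φz r s π* y) + sumFin n (λ y → Ψz r s′ π* y - Ψz r s π* y)
      ≡⟨ sumFin-+ n _ _ ⟨
    sumFin n (λ y → (Φz r s′ π* y - Φz r s π* y) + (Ψz r s′ π* y - Ψz r s π* y)) ∎
    where open ≡-Reasoning

-- One fetch inside the loop

open import Data.Rational using (ℚ; 0ℚ; _≤_; _+_; _-_)

module FetchStep {n} (r : ℕ) (s : State n) (bounded : ∀ y → Bounded inLoop (budget s y) (pos s y))
                 (π* : Fin n → ℕ) (π*-perm : IsPerm n π*)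
                 (z : Fin n) (z-due : ℕ→ℚ (pos s z) ≤ budget s z) where
  import Data.Nat as ℕ
  import Data.Nat.Properties as ℕ
  open import Data.Nat.DivMod using (_/_; m*n/n≡m; /-monoˡ-≤; m/n*n≤m)
  import Data.Fin.Properties as Fin
  open import Data.Bool using (Bool; if_then_else_)
  open import Data.Rational using (_*_; -_)
  open import Data.Rational.Properties
  open import Data.Product using (proj₁; proj₂)
  open import Data.Sum using ([_,_]′)
  open import Relation.Binary.PropositionalEquality
  open import Relation.Nullary using (Dec; yes; no; does)
  open import Relation.Nullary.Decidable using (dec-true; dec-false)

  private
    k = pos s z
    κ = κc r
    instance
      2^κ≢0 : ℕ.NonZero (2 ℕ.^ κ)
      2^κ≢0 = ℕ.m^n≢0 2 κ

  P : Fin n → ℕ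
  P y = pexp (π* y) ℕ.+ κ

  inOffPrefix : Fin n → Bool
  inOffPrefix y = does (π* y ℕ.≤? (2 ℕ.* k) / 2 ℕ.^ κ)

  bound : Fin n → ℚ
  bound y = (if does (y Fin.≟ z) then - (ℕ→ℚ 2 * ℕ→ℚ k) else 0ℚ) + (if inOffPrefix y then ℕ→ℚ 3 * βc r else 0ℚ)

  Δ≤bound : ∀ y → Δ r (P y) (pos s y) (pos (fetch s z) y) (budget s y) (budget (fetch s z) y) ≤ bound y
  Δ≤bound y = by-cases (y Fin.≟ z)
    where
    open ≤-Reasoning
    j = pos s y
    b = budget s y
    extra = if inOffPrefix y then ℕ→ℚ 3 * βc r else 0ℚ

    0≤extra : 0ℚ ≤ extra
    0≤extra = 0≤if (inOffPrefix y) (0≤* (0≤ℕ→ℚ 3) (0≤β r))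

    bound-other : y ≢ z → bound y ≡ extra
    bound-other y≢z = trans (cong (λ c → (if c then - (ℕ→ℚ 2 * ℕ→ℚ k) else 0ℚ) + extra) (dec-false (y Fin.≟ z) y≢z))
                            (+-identityˡ extra)

    shifted : j ℕ.< k → Δ r (P y) j (ℕ.suc j) b b ≤ extra
    shifted j<k = [ below , crossing ]′ (ℕ.<-≤-connex (pexp (ℕ.suc j)) (P y))
      where
      below : pexp (ℕ.suc j) ℕ.< P y → Δ r (P y) j (ℕ.suc j) b b ≤ extra
      below p′<P = ≤-trans (≤-reflexive (Δ-below r (P y) {j} {b} p′<P)) 0≤extra
      crossing : P y ℕ.≤ pexp (ℕ.suc j) → Δ r (P y) j (ℕ.suc j) b b ≤ extra
      crossing P≤p′ = ≤-trans (Δ-shift≤3β r (P y) {j} {b} (proj₁ (bounded y)))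
        (≤-reflexive (sym (cong (if_then ℕ→ℚ 3 * βc r else 0ℚ) (dec-true (π* y ℕ.≤? (2 ℕ.* k) / 2 ℕ.^ κ) π*≤V))))
        where
        π*≤V : π* y ℕ.≤ (2 ℕ.* k) / 2 ℕ.^ κ
        π*≤V = ℕ.≤-trans (ℕ.≤-reflexive (sym (m*n/n≡m (π* y) (2 ℕ.^ κ))))
                         (/-monoˡ-≤ (2 ℕ.^ κ) (crossing-bound (π* y) κ P≤p′ j<k))

    moved : y ≢ z → Dec (j ℕ.< k) → Δ r (P y) j (pos (fetch s z) y) b (budget (fetch s z) y) ≤ bound y
    moved y≢z (yes j<k) = begin
      Δ r (P y) j (pos (fetch s z) y) b (budget (fetch s z) y)
        ≡⟨ cong₂ (λ j′ b′ → Δ r (P y) j j′ b b′) (fetchPos-before (pos s) y≢z j<k) (fetch-budget-other s y≢z) ⟩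
      Δ r (P y) j (ℕ.suc j) b b ≤⟨ shifted j<k ⟩
      extra                     ≡⟨ bound-other y≢z ⟨
      bound y                   ∎
    moved y≢z (no j≮k) = begin
      Δ r (P y) j (pos (fetch s z) y) b (budget (fetch s z) y)
        ≡⟨ cong₂ (λ j′ b′ → Δ r (P y) j j′ b b′) (fetchPos-after (pos s) y≢z j≮k) (fetch-budget-other s y≢z) ⟩
      Δ r (P y) j j b b ≡⟨ Δ-unchanged r (P y) j b ⟩
      0ℚ                ≤⟨ 0≤extra ⟩
      extra             ≡⟨ bound-other y≢z ⟨
      bound y           ∎

    by-cases : Dec (y ≡ z) → Δ r (P y) j (pos (fetch s z) y) b (budget (fetch s z) y) ≤ bound y
    by-cases (yes refl) = begin
      Δ r (P y) j (pos (fetch s y) y) b (budget (fetch s y) y)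
        ≡⟨ cong₂ (λ j′ b′ → Δ r (P y) j j′ b b′) (fetchPos-self (pos s) {y}) (fetch-budget-self s {y}) ⟩
      Δ r (P y) j 1 b 0ℚ        ≤⟨ Δ-fetched r (P y) {k} {b} z-due (proj₂ (bounded y)) ⟩
      - (ℕ→ℚ 2 * ℕ→ℚ k)         ≤⟨ p≤p+q 0≤extra ⟩
      - (ℕ→ℚ 2 * ℕ→ℚ k) + extra
        ≡⟨ cong (λ c → (if c then - (ℕ→ℚ 2 * ℕ→ℚ k) else 0ℚ) + extra) (dec-true (y Fin.≟ y) refl) ⟨
      bound y                   ∎
    by-cases (no y≢z) = moved y≢z (j ℕ.<? k)

  sum-bound : sumFin n bound ≡ - (ℕ→ℚ 2 * ℕ→ℚ k) + ℕ→ℚ 3 * βc r * ℕ→ℚ (count n inOffPrefix)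
  sum-bound = trans (sumFin-+ n _ _)
                    (cong₂ _+_ (sumFin-single n z (- (ℕ→ℚ 2 * ℕ→ℚ k))) (sumFin-if n inOffPrefix (ℕ→ℚ 3 * βc r)))

  6β*count≤2k : (45 ℕ.* r ℕ.+ 30) ℕ.* count n inOffPrefix ℕ.≤ 2 ℕ.* k
  6β*count≤2k = begin
    (45 ℕ.* r ℕ.+ 30) ℕ.* count n inOffPrefix ≤⟨ ℕ.*-monoˡ-≤ (count n inOffPrefix) (n≤2^⌈log₂n⌉ (45 ℕ.* r ℕ.+ 30)) ⟩
    2 ℕ.^ κ ℕ.* count n inOffPrefix           ≤⟨ ℕ.*-monoʳ-≤ (2 ℕ.^ κ) count≤V ⟩
    2 ℕ.^ κ ℕ.* V                             ≡⟨ ℕ.*-comm (2 ℕ.^ κ) V ⟩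
    V ℕ.* 2 ℕ.^ κ                             ≤⟨ m/n*n≤m (2 ℕ.* k) (2 ℕ.^ κ) ⟩
    2 ℕ.* k                                   ∎
    where
    open ℕ.≤-Reasoning
    V = (2 ℕ.* k) / 2 ℕ.^ κ
    count≤V : count n inOffPrefix ℕ.≤ V
    count≤V = count-≤-injective n π* (λ {y} {y′} → proj₂ π*-perm y y′) (λ y → proj₁ (proj₁ π*-perm y)) V

lemma8 : {n r : ℕ} {s : State n} → Reach r inLoop s →
         (π* : Fin n → ℕ) → IsPerm n π* →
         (z : Fin n) → ℕ→ℚ (pos s z) ≤ budget s z →
         ℕ→ℚ (fetchCost s z)
           + (Φ r (fetch s z) π* - Φ r s π*)
           + (Ψ r (fetch s z) π* - Ψ r s π*) ≤ 0ℚ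
lemma8 {n} {r} {s} reach π* π*-perm z z-due = begin
  ℕ→ℚ (k ∸ 1) + ΔΦ + ΔΨ             ≡⟨ +-assoc (ℕ→ℚ (k ∸ 1)) ΔΦ ΔΨ ⟩
  ℕ→ℚ (k ∸ 1) + (ΔΦ + ΔΨ)           ≡⟨ cong (ℕ→ℚ (k ∸ 1) +_) (ΔΦ+ΔΨ≡sumΔ r s (fetch s z) π*) ⟩
  ℕ→ℚ (k ∸ 1) + sumFin n Δs         ≤⟨ +-monoʳ-≤ (ℕ→ℚ (k ∸ 1)) (sumFin-mono n Δ≤bound) ⟩
  ℕ→ℚ (k ∸ 1) + sumFin n bound      ≡⟨ cong (ℕ→ℚ (k ∸ 1) +_) sum-bound ⟩
  ℕ→ℚ (k ∸ 1) + (- (ℕ→ℚ 2 * K) + T) ≤⟨ +-mono-≤ (ℕ→ℚ-mono-≤ {k ∸ 1} {k} (m∸n≤m k 1))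
                                                 (+-monoʳ-≤ (- (ℕ→ℚ 2 * K)) (3β*c≤k r (count n inOffPrefix) k 6β*count≤2k)) ⟩
  K + (- (ℕ→ℚ 2 * K) + K)           ≡⟨ solve 1 (λ K → K :+ (:- (con (ℕ→ℚ 2) :* K) :+ K) := con 0ℚ) refl K ⟩
  0ℚ                                ∎
  where
  open FetchStep r s (reach⇒bounded reach) π* π*-perm z z-due
  open import Data.Nat using (_∸_)
  open import Data.Nat.Properties using (m∸n≤m)
  open import Data.Rational using (_*_; -_)
  open import Data.Rational.Properties using (+-assoc; +-mono-≤; +-monoʳ-≤; module ≤-Reasoning)
  open import Data.Rational.Solver using (module +-*-Solver)
  open +-*-Solver
  open import Relation.Binary.PropositionalEquality using (refl; cong)
  open ≤-Reasoning
  k = pos s z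
  K = ℕ→ℚ k
  ΔΦ = Φ r (fetch s z) π* - Φ r s π*
  ΔΨ = Ψ r (fetch s z) π* - Ψ r s π*
  T = ℕ→ℚ 3 * βc r * ℕ→ℚ (count n inOffPrefix)
  Δs : Fin n → ℚ
  Δs y = Δ r (P y) (pos s y) (pos (fetch s z) y) (budget s y) (budget (fetch s z) y)
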